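{- The class of (finite and infinite) connected directed graphs is not definable in $\mathrm{BndSCL}$: there is no sentence $\varphi$ of $\mathrm{BndSCL}$ such that for every directed graph $G$, $G\models_\omega\varphi$ iff $G$ is connected.
   Context: A directed graph is $(V,E)$ with $E\subseteq V\times V$; it is connected if for all $u\neq v$ in $V$ there is a directed path from $u$ to $v$. Syntax of $\mathrm{BndSCL}$. $\mathrm{FO}$ has equality and $\bot$ as primitives and $\neg,\wedge,\vee,\exists,\forall$. Fix label symbols $L_0,L_1,\dots$ and for each $L$ a claim symbol $C_L$. Formulas: $\mathrm{FO}$ formation rules plus: each $C_L$ is atomic (no free variables); if $\varphi$ is a formula, $L\varphi$ is a formula (same free variables). FO-atoms are atomic formulas of $\mathrm{FO}$. The reference formula of an occurrence of $C_L$ is the subformula occurrence $L\psi$ above it in the syntax tree with no occurrence of $L$ strictly between (if any). Semantics. $\mathcal{G}_n(\mathfrak{A},s,\varphi)$ has positions $(\psi,r,\#,m)$, $\#\in\{+,-\}$, clock $m$, starting at $(\varphi,s,+,n)$. FO-atom $\alpha$: if $\#=+$ Eloise wins iff $\mathfrak{A},r\models\alpha$, else Abelard; if $\#=-$ Abelard wins iff $\mathfrak{A},r\models\alpha$, else Eloise. $\neg$ flips the sign. $\wedge$: Abelard chooses if $+$, Eloise if $-$. $\vee$: Eloise if $+$, Abelard if $-$. $\forall x$: Abelard picks $a\in A$ if $+$, Eloise if $-$, assignment becomes $r[a/x]$. $\exists x$: Eloise if $+$, Abelard if $-$. $L\psi$: move to $\psi$. $C_L$: if $m>0$ move to its reference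 formula with clock $m-1$; if $m=0$ (or no reference formula) the play ends with no winner. $\mathcal{G}_\omega$: Abelard picks $n'$, Eloise picks $n\ge n'$, then $\mathcal{G}_n$. $\mathfrak{A}\models_\omega\varphi$ iff Eloise has a winning strategy in $\mathcal{G}_\omega(\mathfrak{A},\varnothing,\varphi)$. -}

module Defs where

open import Data.Nat using (ℕ; zero; suc; _≤_; _≟_)
open import Data.List using (List; []; _∷_)
open import Data.Maybe using (Maybe; just; nothing)
open import Data.Product using (Σ; ∃; _×_; _,_)
open import Data.Sum using (_⊎_)
open import Relation.Nullary using (¬_; yes; no)
open import Relation.Binary.PropositionalEquality using (_≡_; _≢_)
open import Relation.Binary.Construct.Closure.ReflexiveTransitive using (Star)

record Graph : Set₁ where
  field
    V : Set
    E : V → V → Set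
open Graph public

Connected : Graph → Set
Connected G = (u v : V G) → u ≢ v → Star (E G) u v

-- Syntax of BndSCL over the graph vocabulary {E}
-- Variables and labels are natural numbers; claim L is the claim symbol C_L.

Var Label : Set
Var = ℕ
Label = ℕ

data Fml : Set where
  eqA   : Var → Var → Fml
  edgeA : Var → Var → Fml
  botA  : Fml
  neg   : Fml → Fml
  and   : Fml → Fml → Fml
  or    : Fml → Fml → Fml
  ex    : Var → Fml → Fml
  all   : Var → Fml → Fml
  lab   : Label → Fml → Fml
  claim : Label → Fml

data Free (x : Var) : Fml → Set where
  eq₁   : ∀ {y} → Free x (eqA x y)
  eq₂   : ∀ {y} → Free x (eqA y x)
  edge₁ : ∀ {y} → Free x (edgeA x y)
  edge₂ : ∀ {y} → Free x (edgeA y x)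
  neg′  : ∀ {φ} → Free x φ → Free x (neg φ)
  andˡ  : ∀ {φ ψ} → Free x φ → Free x (and φ ψ)
  andʳ  : ∀ {φ ψ} → Free x ψ → Free x (and φ ψ)
  orˡ   : ∀ {φ ψ} → Free x φ → Free x (or φ ψ)
  orʳ   : ∀ {φ ψ} → Free x ψ → Free x (or φ ψ)
  ex′   : ∀ {y φ} → x ≢ y → Free x φ → Free x (ex y φ)
  all′  : ∀ {y φ} → x ≢ y → Free x φ → Free x (all y φ)
  lab′  : ∀ {L φ} → Free x φ → Free x (lab L φ)

Sentence : Fml → Set
Sentence φ = (x : Var) → ¬ Free x φ

data Sign : Set where
  + - : Sign

flip : Sign → Sign
flip + = -
flip - = +

Assign : Set → Set
Assign A = Var → Maybe A

∅ : {A : Set} → Assign A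
∅ _ = nothing

_[_/_] : {A : Set} → Assign A → A → Var → Assign A
(r [ a / x ]) y with y ≟ x
... | yes _ = just a
... | no  _ = r y

-- Context of a subformula occurrence: the enclosing labelled subformula
-- occurrences L ψ, innermost first (stored as (L , ψ)).
Ctx : Set
Ctx = List (Label × Fml)

-- Reference formula of an occurrence of C_L in context Γ: the innermost
-- enclosing occurrence L ψ, returned as ψ together with the context of
-- that occurrence L ψ.
ref : Label → Ctx → Maybe (Fml × Ctx)
ref L [] = nothing
ref L ((L′ , ψ) ∷ Γ) with L ≟ L′
... | yes _ = just (ψ , Γ)
... | no  _ = ref L Γ

-- Wins G m Γ ψ r s : Eloise has a winning strategy in G_m from the
-- position (ψ , r , s , m), where ψ is the subformula occurrence with
-- context Γ.  (Plays are finite, so this inductive predicate is exactly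
-- the existence of a winning strategy for Eloise.)
data Wins (G : Graph) : ℕ → Ctx → Fml → Assign (V G) → Sign → Set where
  eq+   : ∀ {m Γ r x y a b} → r x ≡ just a → r y ≡ just b → a ≡ b
          → Wins G m Γ (eqA x y) r +
  eq-   : ∀ {m Γ r x y a b} → r x ≡ just a → r y ≡ just b → ¬ (a ≡ b)
          → Wins G m Γ (eqA x y) r -
  edge+ : ∀ {m Γ r x y a b} → r x ≡ just a → r y ≡ just b → E G a b
          → Wins G m Γ (edgeA x y) r +
  edge- : ∀ {m Γ r x y a b} → r x ≡ just a → r y ≡ just b → ¬ (E G a b)
          → Wins G m Γ (edgeA x y) r -
  bot-  : ∀ {m Γ r} → Wins G m Γ botA r -
  negW  : ∀ {m Γ r s φ} → Wins G m Γ φ r (flip s) → Wins G m Γ (neg φ) r s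
  and+  : ∀ {m Γ r φ ψ} → Wins G m Γ φ r + → Wins G m Γ ψ r +
          → Wins G m Γ (and φ ψ) r +
  and-ˡ : ∀ {m Γ r φ ψ} → Wins G m Γ φ r - → Wins G m Γ (and φ ψ) r -
  and-ʳ : ∀ {m Γ r φ ψ} → Wins G m Γ ψ r - → Wins G m Γ (and φ ψ) r -
  or+ˡ  : ∀ {m Γ r φ ψ} → Wins G m Γ φ r + → Wins G m Γ (or φ ψ) r +
  or+ʳ  : ∀ {m Γ r φ ψ} → Wins G m Γ ψ r + → Wins G m Γ (or φ ψ) r +
  or-   : ∀ {m Γ r φ ψ} → Wins G m Γ φ r - → Wins G m Γ ψ r -
          → Wins G m Γ (or φ ψ) r -
  all+  : ∀ {m Γ r x φ} → ((a : V G) → Wins G m Γ φ (r [ a / x ]) +)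
          → Wins G m Γ (all x φ) r +
  all-  : ∀ {m Γ r x φ} (a : V G) → Wins G m Γ φ (r [ a / x ]) -
          → Wins G m Γ (all x φ) r -
  ex+   : ∀ {m Γ r x φ} (a : V G) → Wins G m Γ φ (r [ a / x ]) +
          → Wins G m Γ (ex x φ) r +
  ex-   : ∀ {m Γ r x φ} → ((a : V G) → Wins G m Γ φ (r [ a / x ]) -)
          → Wins G m Γ (ex x φ) r -
  labW  : ∀ {m Γ r s L φ} → Wins G m ((L , φ) ∷ Γ) φ r s
          → Wins G m Γ (lab L φ) r s
  claimW : ∀ {m Γ Γ′ r s L ψ} → ref L Γ ≡ just (ψ , Γ′)
          → Wins G m Γ′ (lab L ψ) r s
          → Wins G (suc m) Γ (claim L) r s

-- G ⊨_ω φ : Abelard picks n′, Eloise answers n ≥ n′ and wins G_n.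
_⊨ω_ : Graph → Fml → Set
G ⊨ω φ = (n′ : ℕ) → Σ ℕ λ n → n′ ≤ n × Wins G n [] φ ∅ +

-- Since G_n unfolds each claim at most n times, whether Eloise wins G_n from the
-- empty assignment is decided by a first-order game of some finite quantifier rank k.
-- Such games cannot tell the line ℤ from two disjoint copies of ℤ, although only
-- the first is connected.  With k rounds left, Duplicator keeps the invariant that
-- two chosen points at distance at most 2^k lie on a common line with the same
-- offset in both graphs, while all other pairs are more than 2^k apart in both.
-- A new point within 2^(k-1) of an old one is copied at the same offset from that
-- point's partner; any other point is answered by a point far from everything
-- chosen so far.

module Submission where

open import Defs hiding (+; -)

open import Data.Bool using (Bool; true; false)
import Data.Bool.Properties as BoolP
open import Data.Empty using (⊥-elim)
open import Data.Integer as ℤ using (ℤ; +_; -[1+_]; ∣_∣; _+_; _-_; 0ℤ; 1ℤ)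
open import Data.Integer.Properties
  using (∣i-j∣≡∣j-i∣; ∣i+j∣≤∣i∣+∣j∣; +-minus-telescope; i-j≡0⇒i≡j; +-inverseʳ; +-identityʳ; +-assoc; pos-+)
open import Data.Integer.Tactic.RingSolver using (solve-∀)
open import Data.List using (_∷_)
open import Data.Maybe using (just; nothing; maybe)
open import Data.Maybe.Relation.Binary.Pointwise as Pw using (Pointwise; just; nothing)
open import Data.Nat as ℕ using (ℕ; zero; suc; _≤_; _<_; _^_; _⊔_; z≤n; s≤s; anyUpTo?)
open import Data.Nat.Properties as ℕ using (≤-trans; +-mono-≤; m≤m+n)
open import Data.Product using (Σ; ∃; ∃₂; _×_; _,_; proj₁; proj₂)
open import Data.Unit using (⊤; tt)
import Data.Unit.Properties as UnitP
open import Function using (_∘_)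
open import Function.Bundles using (_⇔_; Equivalence)
open import Relation.Binary.Construct.Closure.ReflexiveTransitive using (Star; ε; _◅_; reverse)
open import Relation.Binary.Definitions using (DecidableEquality; Symmetric)
open import Relation.Binary.PropositionalEquality
open import Relation.Nullary using (¬_; Dec; yes; no)
import Relation.Nullary.Decidable as Dec

[i+j]-i≡j : ∀ i j → (i + j) - i ≡ j
[i+j]-i≡j = solve-∀

i+[j-i]≡j : ∀ i j → i + (j - i) ≡ j
i+[j-i]≡j = solve-∀

j-[j-i]≡i : ∀ i j → j - (j - i) ≡ i
j-[j-i]≡i = solve-∀

i≡[i-j]+j : ∀ i j → i ≡ (i - j) + j
i≡[i-j]+j = solve-∀

-[i-j]≡j-i : ∀ i j → ℤ.- (i - j) ≡ j - i
-[i-j]≡j-i = solve-∀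

data Adjacent {C : Set} : C × ℤ → C × ℤ → Set where
  adjacent : ∀ {c i j} → ∣ j - i ∣ ≡ 1 → Adjacent (c , i) (c , j)

Lines : Set → Graph
Lines C = record { V = C × ℤ ; E = Adjacent }

adjacent-sym : {C : Set} → Symmetric (Adjacent {C})
adjacent-sym (adjacent {i = i} {j} d) = adjacent (trans (∣i-j∣≡∣j-i∣ i j) d)

module _ {C : Set} where

  data Near (k : ℕ) : C × ℤ → C × ℤ → Set where
    near : ∀ {c i j} → ∣ j - i ∣ ≤ 2 ^ k → Near k (c , i) (c , j)

  near-refl : ∀ {k} (a : C × ℤ) → Near k a a
  near-refl {k} (_ , i) = near (subst (λ d → ∣ d ∣ ≤ 2 ^ k) (sym (+-inverseʳ i)) z≤n)

  near-sym : ∀ {k} {a b : C × ℤ} → Near k a b → Near k b a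
  near-sym {k} (near {i = i} {j} d) = near (subst (_≤ 2 ^ k) (∣i-j∣≡∣j-i∣ j i) d)

  near-suc : ∀ {k} {a b : C × ℤ} → Near k a b → Near (suc k) a b
  near-suc {k} (near d) = near (≤-trans d (m≤m+n (2 ^ k) _))

  near-trans : ∀ {k} {a b e : C × ℤ} → Near k a b → Near k b e → Near (suc k) a e
  near-trans {k} (near {i = i} {j} d₁) (near {j = l} d₂) = near (begin
    ∣ l - i ∣                 ≡⟨ cong ∣_∣ (+-minus-telescope l j i) ⟨
    ∣ (l - j) + (j - i) ∣     ≤⟨ ∣i+j∣≤∣i∣+∣j∣ (l - j) (j - i) ⟩
    ∣ l - j ∣ ℕ.+ ∣ j - i ∣   ≤⟨ +-mono-≤ d₂ d₁ ⟩
    2 ^ k ℕ.+ 2 ^ k           ≡⟨ cong (2 ^ k ℕ.+_) (ℕ.+-identityʳ (2 ^ k)) ⟨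
    2 ^ suc k                 ∎)
    where open ℕ.≤-Reasoning

  adjacent⇒near : ∀ {k} {a b : C × ℤ} → Adjacent a b → Near k a b
  adjacent⇒near {k} (adjacent d) = near (subst (_≤ 2 ^ k) (sym d) (ℕ.m^n>0 2 k))

  near? : DecidableEquality C → ∀ k (a b : C × ℤ) → Dec (Near k a b)
  near? _≟_ k (c , i) (d , j) with c ≟ d | ∣ j - i ∣ ℕ.≤? 2 ^ k
  ... | yes refl | yes l = yes (near l)
  ... | yes refl | no nl = no λ { (near l) → nl l }
  ... | no c≢d   | _     = no λ { (near _) → c≢d refl }

data Agree {C₁ C₂ : Set} (k : ℕ) : C₁ × ℤ → C₁ × ℤ → C₂ × ℤ → C₂ × ℤ → Set where
  same : ∀ {c i j c′ i′ j′} → j - i ≡ j′ - i′ → Agree k (c , i) (c , j) (c′ , i′) (c′ , j′)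
  far  : ∀ {a b a′ b′} → ¬ Near k a b → ¬ Near k a′ b′ → Agree k a b a′ b′

module _ {C₁ C₂ : Set} {k : ℕ} where

  agree-refl : (a : C₁ × ℤ) (a′ : C₂ × ℤ) → Agree k a a a′ a′
  agree-refl (_ , i) (_ , i′) = same (trans (+-inverseʳ i) (sym (+-inverseʳ i′)))

  agree-swap : {a b : C₁ × ℤ} {a′ b′ : C₂ × ℤ} → Agree k a b a′ b′ → Agree k a′ b′ a b
  agree-swap (same d)     = same (sym d)
  agree-swap (far n₁ n₂) = far n₂ n₁

  agree-sym : {a b : C₁ × ℤ} {a′ b′ : C₂ × ℤ} → Agree k a b a′ b′ → Agree k b a b′ a′
  agree-sym (same {i = i} {j} {i′ = i′} {j′} d) = same (begin
    i - j          ≡⟨ -[i-j]≡j-i j i ⟨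
    ℤ.- (j - i)    ≡⟨ cong ℤ.-_ d ⟩
    ℤ.- (j′ - i′)  ≡⟨ -[i-j]≡j-i j′ i′ ⟩
    i′ - j′        ∎)
    where open ≡-Reasoning
  agree-sym (far n₁ n₂) = far (n₁ ∘ near-sym) (n₂ ∘ near-sym)

  agree-≡ : {a b : C₁ × ℤ} {a′ b′ : C₂ × ℤ} → Agree k a b a′ b′ → a ≡ b → a′ ≡ b′
  agree-≡ (same {i = i} {i′ = i′} {j′} d) refl =
    cong (_ ,_) (sym (i-j≡0⇒i≡j j′ i′ (trans (sym d) (+-inverseʳ i))))
  agree-≡ (far n _) refl = ⊥-elim (n (near-refl _))

  agree-adjacent : {a b : C₁ × ℤ} {a′ b′ : C₂ × ℤ} → Agree k a b a′ b′ → Adjacent a b → Adjacent a′ b′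
  agree-adjacent (same d) (adjacent one) = adjacent (trans (cong ∣_∣ (sym d)) one)
  agree-adjacent (far n _) adj = ⊥-elim (n (adjacent⇒near adj))

agree-pred : ∀ {C₁ C₂ k} {a b : C₁ × ℤ} {a′ b′ : C₂ × ℤ} → Agree (suc k) a b a′ b′ → Agree k a b a′ b′
agree-pred (same d)    = same d
agree-pred (far n₁ n₂) = far (n₁ ∘ near-suc) (n₂ ∘ near-suc)

copy : {C₁ C₂ : Set} → C₁ × ℤ → C₁ × ℤ → C₂ × ℤ → C₂ × ℤ
copy (_ , i) (_ , j) (c′ , i′) = c′ , i′ + (j - i)

module _ {C₁ C₂ : Set} {k : ℕ} where

  near-copy : {a b : C₁ × ℤ} (b′ : C₂ × ℤ) → Near k b a → Near k b′ (copy b a b′)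
  near-copy (_ , i′) (near {i = i} {j} d) =
    near (subst (λ x → ∣ x ∣ ≤ 2 ^ k) (sym ([i+j]-i≡j i′ (j - i))) d)

  agree-copy : {a b e : C₁ × ℤ} {b′ e′ : C₂ × ℤ} →
               Near k b a → Agree (suc k) b e b′ e′ → Agree k e a e′ (copy b a b′)
  agree-copy (near {i = i} {j} _) (same {j = l} {i′ = i′} {l′} d) = same (begin
    j - l                 ≡⟨ telescope j i l ⟨
    (j - i) - (l - i)     ≡⟨ cong ((j - i) -_) d ⟩
    (j - i) - (l′ - i′)   ≡⟨ regroup i′ (j - i) l′ ⟨
    (i′ + (j - i)) - l′   ∎)
    where
    open ≡-Reasoning
    regroup : ∀ x y z → (x + y) - z ≡ y - (z - x)
    regroup = solve-∀
    telescope : ∀ x y z → (x - y) - (z - y) ≡ x - z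
    telescope = solve-∀
  agree-copy {b′ = b′} ba (far n₁ n₂) =
    far (λ ea → n₁ (near-trans ba (near-sym ea)))
        (λ ea′ → n₂ (near-trans (near-copy b′ ba) (near-sym ea′)))

radius : {C : Set} → Assign (C × ℤ) → ℕ → ℕ
radius r zero    = 0
radius r (suc n) = radius r n ⊔ maybe (λ a → ∣ proj₂ a ∣) 0 (r n)

radius-bound : {C : Set} (r : Assign (C × ℤ)) {n x : ℕ} {c : C} {i : ℤ} →
               x < n → r x ≡ just (c , i) → ∣ i ∣ ≤ radius r n
radius-bound r {suc n} {x} x<1+n e with x ℕ.≟ n
... | yes refl rewrite e = ℕ.m≤n⊔m (radius r n) _
... | no x≢n = ≤-trans (radius-bound r (ℕ.≤∧≢⇒< (ℕ.≤-pred x<1+n) x≢n) e) (ℕ.m≤m⊔n (radius r n) _)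

record Matching {C₁ C₂ : Set} (k : ℕ) (r : Assign (C₁ × ℤ)) (r′ : Assign (C₂ × ℤ)) : Set where
  field
    size    : ℕ
    beyond  : ∀ {x} → size ≤ x → r x ≡ nothing
    sameDom : ∀ x → Pointwise (λ _ _ → ⊤) (r x) (r′ x)
    agree   : ∀ {x y a b a′ b′} → r x ≡ just a → r y ≡ just b →
              r′ x ≡ just a′ → r′ y ≡ just b′ → Agree k a b a′ b′

  partner : ∀ {x a} → r x ≡ just a → ∃ λ a′ → r′ x ≡ just a′
  partner {x} e with r x | r′ x | sameDom x
  partner () | nothing | _ | nothing
  ... | just _ | just a′ | just _ = a′ , refl

  assigned⇒<size : ∀ {x a} → r x ≡ just a → x < size
  assigned⇒<size {x} e with x ℕ.<? size
  ... | yes x<size = x<size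
  ... | no x≮size with () ← trans (sym e) (beyond (ℕ.≮⇒≥ x≮size))

  matched : ∀ {x y a b} → r x ≡ just a → r y ≡ just b →
            ∃₂ λ a′ b′ → r′ x ≡ just a′ × r′ y ≡ just b′ × Agree k a b a′ b′
  matched x↦a y↦b with partner x↦a | partner y↦b
  ... | a′ , x↦a′ | b′ , y↦b′ = a′ , b′ , x↦a′ , y↦b′ , agree x↦a y↦b x↦a′ y↦b′

  beyond′ : ∀ {x} → size ≤ x → r′ x ≡ nothing
  beyond′ {x} l with r x | r′ x | sameDom x | beyond l
  ... | nothing | nothing | nothing | _ = refl

open Matching

matching-∅ : ∀ {C₁ C₂ k} → Matching {C₁} {C₂} k ∅ ∅
matching-∅ = record { size = 0 ; beyond = λ _ → refl ; sameDom = λ _ → nothing ; agree = λ () }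

matching-swap : ∀ {C₁ C₂ k r r′} → Matching {C₁} {C₂} k r r′ → Matching k r′ r
matching-swap M = record
  { size    = size M
  ; beyond  = beyond′ M
  ; sameDom = λ x → Pw.sym _ (sameDom M x)
  ; agree   = λ e₁ e₂ e₃ e₄ → agree-swap (agree M e₃ e₄ e₁ e₂)
  }

module _ {C₁ C₂ : Set} {k : ℕ} {r : Assign (C₁ × ℤ)} {r′ : Assign (C₂ × ℤ)} where

  extend : Matching (suc k) r r′ → ∀ x (a : C₁ × ℤ) (a′ : C₂ × ℤ) →
           (∀ {y b b′} → r y ≡ just b → r′ y ≡ just b′ → Agree k b a b′ a′) →
           Matching k (r [ a / x ]) (r′ [ a′ / x ])
  extend M x a a′ fresh = record
    { size    = suc x ⊔ size M
    ; beyond  = beyond⁺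
    ; sameDom = sameDom⁺
    ; agree   = λ {y} {z} → agree⁺ {y} {z}
    }
    where
    beyond⁺ : ∀ {y} → suc x ⊔ size M ≤ y → (r [ a / x ]) y ≡ nothing
    beyond⁺ {y} l with y ℕ.≟ x
    ... | yes refl = ⊥-elim (ℕ.<-irrefl refl (ℕ.m⊔n≤o⇒m≤o (suc y) (size M) l))
    ... | no _     = beyond M (ℕ.m⊔n≤o⇒n≤o (suc x) _ l)

    sameDom⁺ : ∀ y → Pointwise (λ _ _ → ⊤) ((r [ a / x ]) y) ((r′ [ a′ / x ]) y)
    sameDom⁺ y with y ℕ.≟ x
    ... | yes _ = just tt
    ... | no _  = sameDom M y

    agree⁺ : ∀ {y z b e b′ e′} → (r [ a / x ]) y ≡ just b → (r [ a / x ]) z ≡ just e →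
             (r′ [ a′ / x ]) y ≡ just b′ → (r′ [ a′ / x ]) z ≡ just e′ → Agree k b e b′ e′
    agree⁺ {y} {z} e₁ e₂ e₃ e₄ with y ℕ.≟ x | z ℕ.≟ x
    agree⁺ refl refl refl refl | yes _ | yes _ = agree-refl a a′
    agree⁺ refl e₂ refl e₄     | yes _ | no _  = agree-sym (fresh e₂ e₄)
    agree⁺ e₁ refl e₃ refl     | no _  | yes _ = fresh e₁ e₃
    agree⁺ {y} {z} e₁ e₂ e₃ e₄ | no _  | no _  = agree-pred (agree M {y} {z} e₁ e₂ e₃ e₄)

outside-ball : ∀ {R T} (v : ℤ) → ∣ v ∣ ≤ R → ¬ ∣ + (R ℕ.+ suc T) - v ∣ ≤ T
outside-ball {R} {T} v v≤R w-v≤T = ℕ.<-irrefl refl (begin-strict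
  R ℕ.+ T                    <⟨ ℕ.+-monoʳ-< R (ℕ.n<1+n T) ⟩
  ∣ w ∣                      ≡⟨ cong ∣_∣ (i≡[i-j]+j w v) ⟩
  ∣ (w - v) + v ∣            ≤⟨ ∣i+j∣≤∣i∣+∣j∣ (w - v) v ⟩
  ∣ w - v ∣ ℕ.+ ∣ v ∣        ≤⟨ +-mono-≤ w-v≤T v≤R ⟩
  T ℕ.+ R                    ≡⟨ ℕ.+-comm T R ⟩
  R ℕ.+ T                    ∎)
  where
  open ℕ.≤-Reasoning
  w = + (R ℕ.+ suc T)

near-assigned? : ∀ {C} → DecidableEquality C → ∀ k (r : Assign (C × ℤ)) (a : C × ℤ) y →
                 Dec (∃ λ b → r y ≡ just b × Near k b a)
near-assigned? _≟_ k r a y with r y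
... | nothing = no λ ()
... | just b  = Dec.map′ (λ ba → b , refl , ba) (λ { (_ , refl , ba) → ba }) (near? _≟_ k b a)

forth : ∀ {C₁ C₂} → DecidableEquality C₁ → C₂ → ∀ {k r r′} → Matching {C₁} {C₂} (suc k) r r′ →
        ∀ x (a : C₁ × ℤ) → ∃ λ a′ → Matching k (r [ a / x ]) (r′ [ a′ / x ])
forth _≟_ c₂ {k} {r} {r′} M x a with anyUpTo? (near-assigned? _≟_ k r a) (size M)
... | yes (_ , _ , b , e , ba) = copy b a b′ , extend M x a _ λ e₁ e₂ → agree-copy ba (agree M e e₁ e′ e₂)
  where
  b′ = proj₁ (partner M e)
  e′ = proj₂ (partner M e)
... | no none = a′ , extend M x a a′ λ e₁ e₂ →
  far (λ ba → none (_ , assigned⇒<size M e₁ , _ , e₁ , ba))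
      (λ { (near {i = i} d) → outside-ball i (radius-bound r′ (assigned⇒<size (matching-swap M) e₂) e₂) d })
  where
  a′ = c₂ , + (radius r′ (size M) ℕ.+ suc (2 ^ k))

⊔-left : ∀ {m n o} → m ⊔ n ≤ o → m ≤ o
⊔-left {m} {n} = ℕ.m⊔n≤o⇒m≤o m n

⊔-right : ∀ {m n o} → m ⊔ n ≤ o → n ≤ o
⊔-right {m} {n} = ℕ.m⊔n≤o⇒n≤o m n

-- The quantifier rank of the position (φ, Γ) of G_m, with every claim unfolded
-- into its reference formula (at most m times along any play).
rank : ℕ → Ctx → Fml → ℕ
rank m Γ (eqA _ _)        = 0
rank m Γ (edgeA _ _)      = 0
rank m Γ botA             = 0
rank m Γ (neg φ)          = rank m Γ φ
rank m Γ (and φ ψ)        = rank m Γ φ ⊔ rank m Γ ψ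
rank m Γ (or φ ψ)         = rank m Γ φ ⊔ rank m Γ ψ
rank m Γ (ex _ φ)         = suc (rank m Γ φ)
rank m Γ (all _ φ)        = suc (rank m Γ φ)
rank m Γ (lab L φ)        = rank m ((L , φ) ∷ Γ) φ
rank zero Γ (claim L)     = 0
rank (suc m) Γ (claim L)  = maybe (λ (ψ , Δ) → rank m Δ (lab L ψ)) 0 (ref L Γ)

module _ {C₁ C₂ : Set} (_≟₁_ : DecidableEquality C₁) (_≟₂_ : DecidableEquality C₂) (c₁ : C₁) (c₂ : C₂) where

  back : ∀ {k r r′} → Matching {C₁} {C₂} (suc k) r r′ →
         ∀ x (a′ : C₂ × ℤ) → ∃ λ a → Matching k (r [ a / x ]) (r′ [ a′ / x ])
  back M x a′ with forth _≟₂_ c₁ (matching-swap M) x a′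
  ... | a , M′ = a , matching-swap M′

  wins-transfer : ∀ {m Γ φ r s k r′} → Wins (Lines C₁) m Γ φ r s → rank m Γ φ ≤ k →
                  Matching k r r′ → Wins (Lines C₂) m Γ φ r′ s
  wins-transfer (eq+ x↦a y↦b a≡b) _ M with matched M x↦a y↦b
  ... | _ , _ , x↦a′ , y↦b′ , ag = eq+ x↦a′ y↦b′ (agree-≡ ag a≡b)
  wins-transfer (eq- x↦a y↦b a≢b) _ M with matched M x↦a y↦b
  ... | _ , _ , x↦a′ , y↦b′ , ag = eq- x↦a′ y↦b′ (a≢b ∘ agree-≡ (agree-swap ag))
  wins-transfer (edge+ x↦a y↦b ab) _ M with matched M x↦a y↦b
  ... | _ , _ , x↦a′ , y↦b′ , ag = edge+ x↦a′ y↦b′ (agree-adjacent ag ab)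
  wins-transfer (edge- x↦a y↦b ¬ab) _ M with matched M x↦a y↦b
  ... | _ , _ , x↦a′ , y↦b′ , ag = edge- x↦a′ y↦b′ (¬ab ∘ agree-adjacent (agree-swap ag))
  wins-transfer bot- _ _ = bot-
  wins-transfer (negW w) l M = negW (wins-transfer w l M)
  wins-transfer (and+ w v) l M = and+ (wins-transfer w (⊔-left l) M) (wins-transfer v (⊔-right l) M)
  wins-transfer (and-ˡ w) l M = and-ˡ (wins-transfer w (⊔-left l) M)
  wins-transfer (and-ʳ w) l M = and-ʳ (wins-transfer w (⊔-right l) M)
  wins-transfer (or+ˡ w) l M = or+ˡ (wins-transfer w (⊔-left l) M)
  wins-transfer (or+ʳ w) l M = or+ʳ (wins-transfer w (⊔-right l) M)
  wins-transfer (or- w v) l M = or- (wins-transfer w (⊔-left l) M) (wins-transfer v (⊔-right l) M)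
  wins-transfer (all+ {x = x} w) (s≤s l) M =
    all+ λ a′ → let a , M′ = back M x a′ in wins-transfer (w a) l M′
  wins-transfer (all- {x = x} a w) (s≤s l) M =
    let a′ , M′ = forth _≟₁_ c₂ M x a in all- a′ (wins-transfer w l M′)
  wins-transfer (ex+ {x = x} a w) (s≤s l) M =
    let a′ , M′ = forth _≟₁_ c₂ M x a in ex+ a′ (wins-transfer w l M′)
  wins-transfer (ex- {x = x} w) (s≤s l) M =
    ex- λ a′ → let a , M′ = back M x a′ in wins-transfer (w a) l M′
  wins-transfer (labW w) l M = labW (wins-transfer w l M)
  wins-transfer {k = k} (claimW {m = m} {L = L} e w) l M =
    claimW e (wins-transfer w (subst (λ z → maybe (λ (ψ , Δ) → rank m Δ (lab L ψ)) 0 z ≤ k) e l) M)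

  ⊨ω-transfer : ∀ {φ} → Lines C₁ ⊨ω φ → Lines C₂ ⊨ω φ
  ⊨ω-transfer {φ} sat n′ =
    let n , n′≤n , w = sat n′ in n , n′≤n , wins-transfer w ℕ.≤-refl matching-∅

module _ {C : Set} (c : C) where

  climb : ∀ i n → Star Adjacent (c , i) (c , i + + n)
  climb i zero    = subst (λ j → Star Adjacent (c , i) (c , j)) (sym (+-identityʳ i)) ε
  climb i (suc n) = up ◅ subst (λ j → Star Adjacent (c , i + 1ℤ) (c , j)) regroup (climb (i + 1ℤ) n)
    where
    up : Adjacent (c , i) (c , i + 1ℤ)
    up = adjacent (cong ∣_∣ ([i+j]-i≡j i 1ℤ))
    regroup : (i + 1ℤ) + + n ≡ i + + suc n
    regroup = trans (+-assoc i 1ℤ (+ n)) (cong (λ d → i + d) (sym (pos-+ 1 n)))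

  line-path : ∀ i j → Star Adjacent (c , i) (c , j)
  line-path i j with j - i in δ
  ... | + n      = subst (λ l → Star Adjacent (c , i) (c , l))
                         (trans (cong (λ d → i + d) (sym δ)) (i+[j-i]≡j i j)) (climb i n)
  ... | -[1+ n ] = subst (λ l → Star Adjacent (c , l) (c , j))
                         (trans (cong (j -_) (sym δ)) (j-[j-i]≡i i j)) (reverse adjacent-sym (climb j (suc n)))

line-connected : Connected (Lines ⊤)
line-connected (tt , i) (tt , j) _ = line-path tt i j

components-preserved : ∀ {C} {a b : C × ℤ} → Star Adjacent a b → proj₁ a ≡ proj₁ b
components-preserved ε               = refl
components-preserved (adjacent _ ◅ p) = components-preserved p

two-lines-disconnected : ¬ Connected (Lines Bool)
two-lines-disconnected connected with components-preserved (connected (true , 0ℤ) (false , 0ℤ) λ ())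
... | ()

proposition3p12 : ¬ (Σ Fml λ φ → Sentence φ ×
                    ((G : Graph) → V G → (G ⊨ω φ) ⇔ Connected G))
proposition3p12 (φ , _ , defines) =
  two-lines-disconnected (Equivalence.to (defines (Lines Bool) (true , 0ℤ)) two-lines-⊨φ)
  where
  line-⊨φ : Lines ⊤ ⊨ω φ
  line-⊨φ = Equivalence.from (defines (Lines ⊤) (tt , 0ℤ)) line-connected
  two-lines-⊨φ : Lines Bool ⊨ω φ
  two-lines-⊨φ = ⊨ω-transfer UnitP._≟_ BoolP._≟_ tt true line-⊨φ
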